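{- Let $G$ be a graph on $n$ vertices and let $1\le n_1\le n_2$ with $n_1+n_2=n$. Let $\{V_1,V_2\}$ and $\{V_1',V_2'\}$ be partitions of $V(G)$ with $|V_1|=|V_1'|=n_1$ and $|V_2|=|V_2'|=n_2$, such that $G[V_1]$ and $G[V_2]$ together contain $x$ missing edges, $G[V_1']$ contains no missing edge and $G[V_2']$ contains $x$ missing edges. Then $d(\{V_1,V_2\})\le d(\{V_1',V_2'\})$.
   Context: A missing edge inside a vertex set $S$ is a pair of distinct non-adjacent vertices of $S$. For $S\subseteq V$, $d(S)=|E(S)|/|S|$ with $E(S)$ the set of edges with both endpoints in $S$; for a partition $\mathcal{P}$, $d(\mathcal{P})=\sum_{P\in\mathcal{P}}d(P)$. -}

module Defs where

open import Data.Bool using (Bool; true; false; _∧_; not; if_then_else_)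
open import Data.Nat using (ℕ; zero; suc; _<ᵇ_)
open import Data.Fin using (Fin; toℕ)
open import Data.Fin.Subset using (Subset; ∣_∣)
open import Data.Vec using (lookup)
open import Data.List using (List; allFin; concatMap; map; filterᵇ; length)
open import Data.Product using (_×_; _,_)
open import Data.Integer using (+_)
open import Data.Rational using (ℚ; 0ℚ; _/_; _+_)
open import Relation.Binary.PropositionalEquality using (_≡_)

record Graph (n : ℕ) : Set where
  field
    adj     : Fin n → Fin n → Bool
    adj-sym : ∀ i j → adj i j ≡ adj j i
    loopless : ∀ i → adj i i ≡ false
open Graph public

allPairs : (n : ℕ) → List (Fin n × Fin n)
allPairs n = concatMap (λ i → map (λ j → (i , j)) (allFin n)) (allFin n)

-- both endpoints in S, and i < j (so each unordered pair is counted once)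
pairIn : ∀ {n} → Subset n → Fin n × Fin n → Bool
pairIn S (i , j) = (toℕ i <ᵇ toℕ j) ∧ lookup S i ∧ lookup S j

edgesIn : ∀ {n} → Graph n → Subset n → ℕ
edgesIn {n} G S = length (filterᵇ (λ { (i , j) → pairIn S (i , j) ∧ adj G i j }) (allPairs n))

missingIn : ∀ {n} → Graph n → Subset n → ℕ
missingIn {n} G S = length (filterᵇ (λ { (i , j) → pairIn S (i , j) ∧ not (adj G i j) }) (allPairs n))

-- d(S) = |E(S)| / |S|  (convention: 0 for the empty set, which never occurs below)
density : ∀ {n} → Graph n → Subset n → ℚ
density G S with ∣ S ∣
... | zero  = 0ℚ
... | suc k = (+ edgesIn G S) / suc k

density₂ : ∀ {n} → Graph n → Subset n → Subset n → ℚ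
density₂ G A B = density G A + density G B

-- In every vertex set S, edges and missing edges together make up all |S| choose 2 pairs.
-- As the parts have the same sizes n₁ and n₂ in both partitions, e(V₁') = e(V₁) + m(V₁) and
-- e(V₂) = e(V₂') + m(V₁), where m counts missing edges (m(V₁) + m(V₂) = x = m(V₂')). Hence
-- d(V₁,V₂) = e(V₁)/n₁ + (e(V₂') + m(V₁))/n₂ and d(V₁',V₂') = (e(V₁) + m(V₁))/n₁ + e(V₂')/n₂,
-- and the first is the smaller since m(V₁)/n₂ ≤ m(V₁)/n₁.
module Submission where

open import Defs
open import Data.Bool using (Bool; true; false; _∧_; not)
open import Data.Nat using (ℕ; zero; suc; _≤_; _+_; s≤s; z≤n)
open import Data.Nat.Properties using (+-assoc; +-suc; +-identityʳ; +-cancelʳ-≡)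
open import Data.Nat.Combinatorics using (_C_; nC1≡n; nCk+nC[k+1]≡[n+1]C[k+1])
open import Data.Fin using (Fin; zero; suc)
open import Data.Fin.Subset using (Subset; ∣_∣; _∩_; _∪_; ⊤; ⊥)
open import Data.Vec using (lookup) renaming ([] to []ᵥ; _∷_ to _∷ᵥ_)
open import Data.List using (List; []; _∷_; _++_; allFin; concatMap; map; filterᵇ; length; tabulate)
open import Data.List.Properties using (map-tabulate)
open import Data.Product using (_×_; _,_)
open import Data.Integer.Base as ℤ using (ℤ; +≤+)
import Data.Integer.Properties as ℤ
open import Data.Integer.Tactic.RingSolver using (solve)
open import Data.Rational using (_/_; toℚᵘ) renaming (_+_ to _+ℚ_; _≤_ to _≤ℚ_)
open import Data.Rational.Properties using (toℚᵘ-cancel-≤; toℚᵘ-homo-+; toℚᵘ-fromℚᵘ)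
open import Data.Rational.Unnormalised as ℚᵘ using (mkℚᵘ; _≃_; *≤*)
import Data.Rational.Unnormalised.Properties as ℚᵘ
open import Algebra.Properties.CommutativeMonoid.Sum Data.Nat.Properties.+-0-commutativeMonoid
  using (sum-cong-≗; sum-syntax)
open import Relation.Binary.PropositionalEquality using (_≡_; refl; sym; trans; cong; cong₂; subst₂; module ≡-Reasoning)

private
  variable
    A B : Set
    n : ℕ

countᵇ : (A → Bool) → List A → ℕ
countᵇ p xs = length (filterᵇ p xs)

countᵇ-++ : ∀ (p : A → Bool) xs ys → countᵇ p (xs ++ ys) ≡ countᵇ p xs + countᵇ p ys
countᵇ-++ p []       ys = refl
countᵇ-++ p (x ∷ xs) ys with p x
... | true  = cong suc (countᵇ-++ p xs ys)
... | false = countᵇ-++ p xs ys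

countᵇ-map : ∀ (p : B → Bool) (f : A → B) xs → countᵇ p (map f xs) ≡ countᵇ (λ x → p (f x)) xs
countᵇ-map p f []       = refl
countᵇ-map p f (x ∷ xs) with p (f x)
... | true  = cong suc (countᵇ-map p f xs)
... | false = countᵇ-map p f xs

countᵇ-false : ∀ (xs : List A) → countᵇ (λ _ → false) xs ≡ 0
countᵇ-false []       = refl
countᵇ-false (x ∷ xs) = countᵇ-false xs

countᵇ-∧+countᵇ-∧-not : ∀ (p q : A → Bool) xs →
  countᵇ (λ x → p x ∧ q x) xs + countᵇ (λ x → p x ∧ not (q x)) xs ≡ countᵇ p xs
countᵇ-∧+countᵇ-∧-not p q []       = refl
countᵇ-∧+countᵇ-∧-not p q (x ∷ xs) with p x | q x
... | true  | true  = cong suc (countᵇ-∧+countᵇ-∧-not p q xs)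
... | true  | false = trans (+-suc _ _) (cong suc (countᵇ-∧+countᵇ-∧-not p q xs))
... | false | _     = countᵇ-∧+countᵇ-∧-not p q xs

allFin-suc : allFin (suc n) ≡ zero ∷ map suc (allFin n)
allFin-suc = cong (zero ∷_) (sym (map-tabulate (λ i → i) suc))

countᵇ-concatMap-tabulate : ∀ (p : B → Bool) (f : A → List B) (g : Fin n → A) →
  countᵇ p (concatMap f (tabulate g)) ≡ ∑[ i < n ] countᵇ p (f (g i))
countᵇ-concatMap-tabulate {n = zero}  p f g = refl
countᵇ-concatMap-tabulate {n = suc n} p f g =
  trans (countᵇ-++ p (f (g zero)) _)
        (cong (countᵇ p (f (g zero)) +_) (countᵇ-concatMap-tabulate p f (λ i → g (suc i))))

countᵇ-lookup : ∀ (S : Subset n) → countᵇ (lookup S) (allFin n) ≡ ∣ S ∣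
countᵇ-lookup {zero}  []ᵥ      = refl
countᵇ-lookup {suc n} (b ∷ᵥ S) = trans (cong (countᵇ (lookup (b ∷ᵥ S))) allFin-suc) (by-head b)
  where
  by-head : ∀ b → countᵇ (lookup (b ∷ᵥ S)) (zero ∷ map suc (allFin n)) ≡ ∣ b ∷ᵥ S ∣
  by-head true  = cong suc (trans (countᵇ-map (lookup (true ∷ᵥ S)) suc (allFin n)) (countᵇ-lookup S))
  by-head false = trans (countᵇ-map (lookup (false ∷ᵥ S)) suc (allFin n)) (countᵇ-lookup S)

countᵇ-allPairs : ∀ (p : Fin n × Fin n → Bool) →
  countᵇ p (allPairs n) ≡ ∑[ i < n ] countᵇ (λ j → p (i , j)) (allFin n)
countᵇ-allPairs {n} p = trans (countᵇ-concatMap-tabulate p (λ i → map (i ,_) (allFin n)) (λ i → i))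
                              (sum-cong-≗ (λ i → countᵇ-map p (i ,_) (allFin n)))

pairsFrom : Subset n → Fin n → ℕ
pairsFrom {n} S i = countᵇ (λ j → pairIn S (i , j)) (allFin n)

pairsFrom-zero : ∀ b (S : Subset n) → pairsFrom (b ∷ᵥ S) zero ≡ countᵇ (λ j → b ∧ lookup S j) (allFin n)
pairsFrom-zero {n} b S = trans (cong (countᵇ p) allFin-suc) (countᵇ-map p suc (allFin n))
  where p = λ j → pairIn (b ∷ᵥ S) (zero , j)

pairsFrom-suc : ∀ b (S : Subset n) i → pairsFrom (b ∷ᵥ S) (suc i) ≡ pairsFrom S i
pairsFrom-suc {n} b S i = trans (cong (countᵇ p) allFin-suc) (countᵇ-map p suc (allFin n))
  where p = λ j → pairIn (b ∷ᵥ S) (suc i , j)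

n+nC2≡[1+n]C2 : ∀ n → n + n C 2 ≡ suc n C 2
n+nC2≡[1+n]C2 n = trans (cong (_+ n C 2) (sym (nC1≡n n))) (nCk+nC[k+1]≡[n+1]C[k+1] n 1)

∑pairsFrom≡C2 : ∀ (S : Subset n) → ∑[ i < n ] pairsFrom S i ≡ ∣ S ∣ C 2
∑pairsFrom≡C2 {zero}  []ᵥ       = refl
∑pairsFrom≡C2 {suc n} (b ∷ᵥ S) = begin
  pairsFrom (b ∷ᵥ S) zero + ∑[ i < n ] pairsFrom (b ∷ᵥ S) (suc i)
    ≡⟨ cong₂ _+_ (pairsFrom-zero b S) (trans (sum-cong-≗ (pairsFrom-suc b S)) (∑pairsFrom≡C2 S)) ⟩
  countᵇ (λ j → b ∧ lookup S j) (allFin n) + ∣ S ∣ C 2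
    ≡⟨ first-row b ⟩
  ∣ b ∷ᵥ S ∣ C 2 ∎
  where
  open ≡-Reasoning
  first-row : ∀ b → countᵇ (λ j → b ∧ lookup S j) (allFin n) + ∣ S ∣ C 2 ≡ ∣ b ∷ᵥ S ∣ C 2
  first-row true  = trans (cong (_+ ∣ S ∣ C 2) (countᵇ-lookup S)) (n+nC2≡[1+n]C2 ∣ S ∣)
  first-row false = cong (_+ ∣ S ∣ C 2) (countᵇ-false (allFin n))

edgesIn+missingIn≡C2 : ∀ (G : Graph n) S → edgesIn G S + missingIn G S ≡ ∣ S ∣ C 2
edgesIn+missingIn≡C2 {n} G S = begin
  edgesIn G S + missingIn G S      ≡⟨ countᵇ-∧+countᵇ-∧-not (pairIn S) (λ (i , j) → adj G i j) (allPairs n) ⟩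
  countᵇ (pairIn S) (allPairs n)   ≡⟨ countᵇ-allPairs (pairIn S) ⟩
  ∑[ i < n ] pairsFrom S i         ≡⟨ ∑pairsFrom≡C2 S ⟩
  ∣ S ∣ C 2                        ∎
  where open ≡-Reasoning

*-+-shift-≤ : ∀ (i j m : ℤ) {p q : ℤ} .{{_ : ℤ.NonNegative m}} → p ℤ.≤ q →
  i ℤ.* q ℤ.+ (j ℤ.+ m) ℤ.* p ℤ.≤ (i ℤ.+ m) ℤ.* q ℤ.+ j ℤ.* p
*-+-shift-≤ i j m {p} {q} p≤q = begin
  i ℤ.* q ℤ.+ (j ℤ.+ m) ℤ.* p     ≡⟨ solve (i ∷ j ∷ m ∷ p ∷ q ∷ []) ⟩
  (i ℤ.* q ℤ.+ j ℤ.* p) ℤ.+ m ℤ.* p ≤⟨ ℤ.+-monoʳ-≤ (i ℤ.* q ℤ.+ j ℤ.* p) (ℤ.*-monoˡ-≤-nonNeg m p≤q) ⟩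
  (i ℤ.* q ℤ.+ j ℤ.* p) ℤ.+ m ℤ.* q ≡⟨ solve (i ∷ j ∷ m ∷ p ∷ q ∷ []) ⟩
  (i ℤ.+ m) ℤ.* q ℤ.+ j ℤ.* p     ∎
  where open ℤ.≤-Reasoning

toℚᵘ-/+/ : ∀ (i j : ℤ) k l → toℚᵘ (i / suc k +ℚ j / suc l) ≃ mkℚᵘ i k ℚᵘ.+ mkℚᵘ j l
toℚᵘ-/+/ i j k l = ℚᵘ.≃-trans (toℚᵘ-homo-+ (i / suc k) (j / suc l))
                              (ℚᵘ.+-cong (toℚᵘ-fromℚᵘ (mkℚᵘ i k)) (toℚᵘ-fromℚᵘ (mkℚᵘ j l)))

/-shift-≤ : ∀ (i j m : ℤ) .{{_ : ℤ.NonNegative m}} {k l} → suc k ≤ suc l →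
  i / suc k +ℚ (j ℤ.+ m) / suc l ≤ℚ (i ℤ.+ m) / suc k +ℚ j / suc l
/-shift-≤ i j m {k} {l} k≤l = toℚᵘ-cancel-≤ (begin
  toℚᵘ (i / suc k +ℚ (j ℤ.+ m) / suc l)   ≃⟨ toℚᵘ-/+/ i (j ℤ.+ m) k l ⟩
  mkℚᵘ i k ℚᵘ.+ mkℚᵘ (j ℤ.+ m) l         ≤⟨ *≤* (ℤ.*-monoʳ-≤-nonNeg _ (*-+-shift-≤ i j m (+≤+ k≤l))) ⟩
  mkℚᵘ (i ℤ.+ m) k ℚᵘ.+ mkℚᵘ j l         ≃⟨ toℚᵘ-/+/ (i ℤ.+ m) j k l ⟨
  toℚᵘ ((i ℤ.+ m) / suc k +ℚ j / suc l)   ∎)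
  where open ℚᵘ.≤-Reasoning

density-/ : ∀ (G : Graph n) S {k} → ∣ S ∣ ≡ suc k → density G S ≡ ℤ.+ edgesIn G S / suc k
density-/ G S eq rewrite eq = refl

edgesIn+missingIn-cong : ∀ (G : Graph n) S T → ∣ S ∣ ≡ ∣ T ∣ →
  edgesIn G S + missingIn G S ≡ edgesIn G T + missingIn G T
edgesIn+missingIn-cong G S T eq = begin
  edgesIn G S + missingIn G S ≡⟨ edgesIn+missingIn≡C2 G S ⟩
  ∣ S ∣ C 2                     ≡⟨ cong (_C 2) eq ⟩
  ∣ T ∣ C 2                     ≡⟨ edgesIn+missingIn≡C2 G T ⟨
  edgesIn G T + missingIn G T ∎
  where open ≡-Reasoning

edgesIn-complete : ∀ (G : Graph n) S T → ∣ S ∣ ≡ ∣ T ∣ → missingIn G T ≡ 0 →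
  edgesIn G T ≡ edgesIn G S + missingIn G S
edgesIn-complete G S T eq complete = begin
  edgesIn G T                   ≡⟨ +-identityʳ (edgesIn G T) ⟨
  edgesIn G T + 0               ≡⟨ cong (edgesIn G T +_) complete ⟨
  edgesIn G T + missingIn G T   ≡⟨ edgesIn+missingIn-cong G T S (sym eq) ⟩
  edgesIn G S + missingIn G S   ∎
  where open ≡-Reasoning

edgesIn-moved : ∀ (G : Graph n) S T m → ∣ S ∣ ≡ ∣ T ∣ → missingIn G T ≡ m + missingIn G S →
  edgesIn G S ≡ edgesIn G T + m
edgesIn-moved G S T m eq moved = +-cancelʳ-≡ (missingIn G S) _ _ (begin
  edgesIn G S + missingIn G S       ≡⟨ edgesIn+missingIn-cong G S T eq ⟩
  edgesIn G T + missingIn G T       ≡⟨ cong (edgesIn G T +_) moved ⟩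
  edgesIn G T + (m + missingIn G S) ≡⟨ +-assoc (edgesIn G T) m (missingIn G S) ⟨
  edgesIn G T + m + missingIn G S   ∎)
  where open ≡-Reasoning

lemma18 : (n : ℕ) (G : Graph n) (n₁ n₂ : ℕ) → 1 ≤ n₁ → n₁ ≤ n₂ → n₁ + n₂ ≡ n →
          (V₁ V₂ V₁' V₂' : Subset n) →
          V₁ ∩ V₂ ≡ ⊥ → V₁ ∪ V₂ ≡ ⊤ → V₁' ∩ V₂' ≡ ⊥ → V₁' ∪ V₂' ≡ ⊤ →
          ∣ V₁ ∣ ≡ n₁ → ∣ V₂ ∣ ≡ n₂ → ∣ V₁' ∣ ≡ n₁ → ∣ V₂' ∣ ≡ n₂ →
          (x : ℕ) → missingIn G V₁ + missingIn G V₂ ≡ x →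
          missingIn G V₁' ≡ 0 → missingIn G V₂' ≡ x →
          density₂ G V₁ V₂ ≤ℚ density₂ G V₁' V₂'
-- Only the part sizes and missing-edge counts matter.
lemma18 n G (suc a) (suc b) (s≤s z≤n) n₁≤n₂ _ V₁ V₂ V₁' V₂' _ _ _ _
        ∣V₁∣ ∣V₂∣ ∣V₁'∣ ∣V₂'∣ x m₁+m₂≡x m₁'≡0 m₂'≡x =
  subst₂ _≤ℚ_ (sym lhs) (sym rhs) (/-shift-≤ (ℤ.+ e₁) (ℤ.+ e₂') (ℤ.+ m₁) n₁≤n₂)
  where
  e₁ = edgesIn G V₁
  e₂' = edgesIn G V₂'
  m₁ = missingIn G V₁

  lhs : density₂ G V₁ V₂ ≡ ℤ.+ e₁ / suc a +ℚ ℤ.+ (e₂' + m₁) / suc b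
  lhs = cong₂ _+ℚ_ (density-/ G V₁ ∣V₁∣)
    (trans (density-/ G V₂ ∣V₂∣)
           (cong (λ e → ℤ.+ e / suc b)
                 (edgesIn-moved G V₂ V₂' m₁ (trans ∣V₂∣ (sym ∣V₂'∣)) (trans m₂'≡x (sym m₁+m₂≡x)))))

  rhs : density₂ G V₁' V₂' ≡ ℤ.+ (e₁ + m₁) / suc a +ℚ ℤ.+ e₂' / suc b
  rhs = cong₂ _+ℚ_
    (trans (density-/ G V₁' ∣V₁'∣)
           (cong (λ e → ℤ.+ e / suc a) (edgesIn-complete G V₁ V₁' (trans ∣V₁∣ (sym ∣V₁'∣)) m₁'≡0)))
    (density-/ G V₂' ∣V₂'∣)
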